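{- Let ${\bf n}$ be the fixed point starting with $0$ of the morphism $0\mapsto01$, $1\mapsto2$, $2\mapsto0$. The nonempty palindromes occurring as factors of ${\bf n}$ are exactly $0,1,2,00,010,101$. -}

module Defs where

open import Data.Nat using (ℕ; zero; suc; _+_)
open import Data.List using (List; []; _∷_; concatMap; length; map; upTo; reverse)
open import Data.Product using (∃-syntax)
open import Relation.Binary.PropositionalEquality using (_≡_)
open import Function using (_∘_)

data Letter : Set where
  a0 a1 a2 : Letter

σ : Letter → List Letter
σ a0 = a0 ∷ a1 ∷ []
σ a1 = a2 ∷ []
σ a2 = a0 ∷ []

σ* : List Letter → List Letter
σ* = concatMap σ

iter : ℕ → List Letter → List Letter
iter zero    w = w
iter (suc k) w = σ* (iter k w)

-- i-th letter of a list, with a default (never used below)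
nth : ℕ → List Letter → Letter
nth _       []       = a0
nth zero    (x ∷ _)  = x
nth (suc i) (_ ∷ xs) = nth i xs

-- The fixed point 𝐧 of σ starting with 0: σ^k(0) is a prefix of σ^(k+1)(0)
-- and has length ≥ k+1, so the i-th letter of 𝐧 is the i-th letter of σ^(i+1)(0).
𝐧 : ℕ → Letter
𝐧 i = nth i (iter (suc i) (a0 ∷ []))

IsFactor : List Letter → Set
IsFactor w = ∃[ i ] (map (λ j → 𝐧 (i + j)) (upTo (length w)) ≡ w)

IsPalindrome : List Letter → Set
IsPalindrome w = reverse w ≡ w

-- A palindrome of length at least 4 has a palindrome of length 4 or 5 at its
-- centre, so only factors of 𝐧 of length at most 5 matter, and these are
-- prefixes of its length-5 windows. Those windows lie in an explicit finite set
-- S₅ containing 0 that is closed under σ: the windows of σ(t) starting inside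
-- the image of the first letter of t ∈ S₅ are again in S₅. Since σ is
-- non-erasing, such a window of σ(w) depends only on the corresponding window
-- of w, so every window of every σᵏ(0), hence of 𝐧, lies in S₅. Checking the
-- prefixes of the words of S₅ leaves exactly the palindromes 0, 1, 2, 00, 010, 101.
module Submission where

open import Defs
open import Data.List using (List; []; _∷_)
open import Data.Sum using (_⊎_)
open import Data.Product using (_×_)
open import Relation.Binary.PropositionalEquality using (_≡_; _≢_)
open import Function.Bundles using (_⇔_)

open import Data.Nat
  using (ℕ; zero; suc; _+_; _≤_; _<_; _≤′_; ≤′-refl; ≤′-step; z≤n; s≤s; z<s)
open import Data.Nat.Properties
  using (≤-refl; ≤-trans; <⇒≤; n≤1+n; m<m+n; +-comm; +-assoc; +-mono-≤; ≤⇒≤′; ≤′⇒≤;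
         module ≤-Reasoning)
open import Data.Fin using (Fin; toℕ; #_)
import Data.Fin.Properties as Fin
open import Data.List
  using (_++_; _∷ʳ_; take; drop; length; applyUpTo; reverse)
open import Data.List.Properties
  using (≡-dec; concatMap-++; length-++; map-upTo; applyUpTo-∷ʳ; take-drop;
         unfold-reverse; reverse-++; ∷-injectiveʳ; ∷ʳ-injectiveˡ)
open import Data.List.Relation.Unary.All as All using (All; []; _∷_; all?)
open import Data.List.Relation.Unary.All.Properties using (++⁺)
open import Data.List.Relation.Unary.Any using (here; there)
open import Data.List.Membership.Propositional using (_∈_; _∉_)
import Data.List.Membership.DecPropositional as DecMembership
open import Data.Sum using (inj₁; inj₂)
open import Data.Product using (_,_)
open import Data.Empty using (⊥-elim)
open import Relation.Nullary using (Dec; yes; no; ¬_)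
open import Relation.Nullary.Decidable using (from-yes; _→-dec_)
open import Relation.Binary.Definitions using (DecidableEquality)
open import Relation.Binary.PropositionalEquality
  using (refl; sym; trans; cong; cong₂; subst; module ≡-Reasoning)
open import Function.Bundles using (mk⇔)
open import Function using (_∘_)

_≟_ : DecidableEquality Letter
a0 ≟ a0 = yes refl
a1 ≟ a1 = yes refl
a2 ≟ a2 = yes refl
a0 ≟ a1 = no λ ()
a0 ≟ a2 = no λ ()
a1 ≟ a0 = no λ ()
a1 ≟ a2 = no λ ()
a2 ≟ a0 = no λ ()
a2 ≟ a1 = no λ ()

open DecMembership (≡-dec _≟_) using (_∈?_)

windows : ∀ {A : Set} → ℕ → List A → List (List A)
windows n []      = []
windows n (x ∷ w) = take n (x ∷ w) ∷ windows n w

windowsFrom : ∀ {A : Set} → ℕ → List A → List A → List (List A)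
windowsFrom n []      v = []
windowsFrom n (y ∷ p) v = take n (y ∷ p ++ v) ∷ windowsFrom n p v

windows-++ : ∀ {A : Set} n (p v : List A) →
  windows n (p ++ v) ≡ windowsFrom n p v ++ windows n v
windows-++ n []      v = refl
windows-++ n (y ∷ p) v = cong (take n (y ∷ p ++ v) ∷_) (windows-++ n p v)

take-++-σ* : ∀ {m k} p w → m ≤ k → take m (p ++ σ* w) ≡ take m (p ++ σ* (take k w))
take-++-σ* {zero}  p        w        _         = refl
take-++-σ* {suc m} (y ∷ p)  w        m<k       = cong (y ∷_) (take-++-σ* p w (<⇒≤ m<k))
take-++-σ* {suc m} []       []       (s≤s _)   = refl
take-++-σ* {suc m} []       (a0 ∷ w) (s≤s m≤k) = cong (a0 ∷_) (take-++-σ* (a1 ∷ []) w m≤k)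
take-++-σ* {suc m} []       (a1 ∷ w) (s≤s m≤k) = cong (a2 ∷_) (take-++-σ* [] w m≤k)
take-++-σ* {suc m} []       (a2 ∷ w) (s≤s m≤k) = cong (a0 ∷_) (take-++-σ* [] w m≤k)

windowsFrom-σ* : ∀ m p w →
  windowsFrom (suc m) p (σ* (take m w)) ≡ windowsFrom (suc m) p (σ* w)
windowsFrom-σ* m []      w = refl
windowsFrom-σ* m (y ∷ p) w =
  cong₂ _∷_ (cong (y ∷_) (sym (take-++-σ* p w ≤-refl))) (windowsFrom-σ* m p w)

σ-windows : ℕ → List Letter → List (List Letter)
σ-windows n []      = []
σ-windows n (x ∷ u) = windowsFrom n (σ x) (σ* u)

σ-Closed : ℕ → List (List Letter) → Set
σ-Closed n S = ∀ {t} → t ∈ S → All (_∈ S) (σ-windows n t)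

windows-σ* : ∀ {m S} → σ-Closed (suc m) S →
  ∀ w → All (_∈ S) (windows (suc m) w) → All (_∈ S) (windows (suc m) (σ* w))
windows-σ* closed []      []         = []
windows-σ* {m} {S} closed (x ∷ w) (t∈S ∷ ws) =
  subst (All (_∈ S)) (sym (windows-++ (suc m) (σ x) (σ* w)))
    (++⁺ (subst (All (_∈ S)) (windowsFrom-σ* m (σ x) w) (closed t∈S))
         (windows-σ* closed w ws))

windows-iter : ∀ {m S} → σ-Closed (suc m) S →
  ∀ k w → All (_∈ S) (windows (suc m) w) → All (_∈ S) (windows (suc m) (iter k w))
windows-iter closed zero    w ws = ws
windows-iter closed (suc k) w ws = windows-σ* closed (iter k w) (windows-iter closed k w ws)

-- Found by computation: the length-5 windows of 𝐧, plus the shorter windows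
-- occurring at the ends of the words σᵏ(0).
S₅ : List (List Letter)
S₅ =
  (a0 ∷ []) ∷ (a0 ∷ a0 ∷ a1 ∷ []) ∷ (a0 ∷ a0 ∷ a1 ∷ a0 ∷ a1 ∷ []) ∷
  (a0 ∷ a0 ∷ a1 ∷ a2 ∷ a0 ∷ []) ∷ (a0 ∷ a1 ∷ []) ∷ (a0 ∷ a1 ∷ a0 ∷ a1 ∷ a2 ∷ []) ∷
  (a0 ∷ a1 ∷ a2 ∷ []) ∷ (a0 ∷ a1 ∷ a2 ∷ a0 ∷ []) ∷ (a0 ∷ a1 ∷ a2 ∷ a0 ∷ a0 ∷ []) ∷
  (a0 ∷ a1 ∷ a2 ∷ a0 ∷ a1 ∷ []) ∷ (a1 ∷ []) ∷ (a1 ∷ a0 ∷ a1 ∷ a2 ∷ []) ∷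
  (a1 ∷ a0 ∷ a1 ∷ a2 ∷ a0 ∷ []) ∷ (a1 ∷ a2 ∷ []) ∷ (a1 ∷ a2 ∷ a0 ∷ []) ∷
  (a1 ∷ a2 ∷ a0 ∷ a0 ∷ a1 ∷ []) ∷ (a1 ∷ a2 ∷ a0 ∷ a1 ∷ a2 ∷ []) ∷ (a2 ∷ []) ∷
  (a2 ∷ a0 ∷ []) ∷ (a2 ∷ a0 ∷ a0 ∷ a1 ∷ []) ∷ (a2 ∷ a0 ∷ a0 ∷ a1 ∷ a0 ∷ []) ∷
  (a2 ∷ a0 ∷ a0 ∷ a1 ∷ a2 ∷ []) ∷ (a2 ∷ a0 ∷ a1 ∷ a2 ∷ a0 ∷ []) ∷ []

S₅-σ-closed : σ-Closed 5 S₅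
S₅-σ-closed = All.lookup
  (from-yes (all? (λ t → all? (_∈? S₅) (σ-windows 5 t)) S₅))

windows-σᵏ0 : ∀ k → All (_∈ S₅) (windows 5 (iter k (a0 ∷ [])))
windows-σᵏ0 k = windows-iter S₅-σ-closed k (a0 ∷ []) (here refl ∷ [])

iter-suc : ∀ k w → iter (suc k) w ≡ iter k (σ* w)
iter-suc zero    w = refl
iter-suc (suc k) w = cong σ* (iter-suc k w)

iter-++ : ∀ k u v → iter k (u ++ v) ≡ iter k u ++ iter k v
iter-++ zero    u v = refl
iter-++ (suc k) u v = trans (cong σ* (iter-++ k u v)) (concatMap-++ σ (iter k u) (iter k v))

σᵏ⁺¹0≡σᵏ0σᵏ1 : ∀ k → iter (suc k) (a0 ∷ []) ≡ iter k (a0 ∷ []) ++ iter k (a1 ∷ [])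
σᵏ⁺¹0≡σᵏ0σᵏ1 k = trans (iter-suc k (a0 ∷ [])) (iter-++ k (a0 ∷ []) (a1 ∷ []))

length-σ* : ∀ w → length w ≤ length (σ* w)
length-σ* []       = z≤n
length-σ* (a0 ∷ w) = s≤s (≤-trans (length-σ* w) (n≤1+n _))
length-σ* (a1 ∷ w) = s≤s (length-σ* w)
length-σ* (a2 ∷ w) = s≤s (length-σ* w)

length-iter : ∀ k w → length w ≤ length (iter k w)
length-iter zero    w = ≤-refl
length-iter (suc k) w = ≤-trans (length-iter k w) (length-σ* (iter k w))

k≤length-σᵏ0 : ∀ k → k ≤ length (iter k (a0 ∷ []))
k≤length-σᵏ0 zero    = z≤n
k≤length-σᵏ0 (suc k) = begin
  suc k                                  ≡⟨ +-comm 1 k ⟩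
  k + 1                                  ≤⟨ +-mono-≤ (k≤length-σᵏ0 k) (length-iter k (a1 ∷ [])) ⟩
  length σᵏ0 + length (iter k (a1 ∷ [])) ≡⟨ length-++ σᵏ0 ⟨
  length (σᵏ0 ++ iter k (a1 ∷ []))       ≡⟨ cong length (σᵏ⁺¹0≡σᵏ0σᵏ1 k) ⟨
  length (iter (suc k) (a0 ∷ []))        ∎
  where
  open ≤-Reasoning
  σᵏ0 = iter k (a0 ∷ [])

nth-++ˡ : ∀ {m} u v → m < length u → nth m (u ++ v) ≡ nth m u
nth-++ˡ {zero}  (x ∷ u) v _         = refl
nth-++ˡ {suc m} (x ∷ u) v (s≤s m<u) = nth-++ˡ u v m<u

nth-σᵏ0 : ∀ {m k} → m < k → nth m (iter k (a0 ∷ [])) ≡ 𝐧 m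
nth-σᵏ0 m<k = stable (≤⇒≤′ m<k)
  where
  stable : ∀ {m k} → suc m ≤′ k → nth m (iter k (a0 ∷ [])) ≡ 𝐧 m
  stable ≤′-refl = refl
  stable {m} (≤′-step {k} m<k) = begin
    nth m (iter (suc k) (a0 ∷ []))  ≡⟨ cong (nth m) (σᵏ⁺¹0≡σᵏ0σᵏ1 k) ⟩
    nth m (σᵏ0 ++ iter k (a1 ∷ [])) ≡⟨ nth-++ˡ σᵏ0 _ (≤-trans (≤′⇒≤ m<k) (k≤length-σᵏ0 k)) ⟩
    nth m σᵏ0                       ≡⟨ stable m<k ⟩
    𝐧 m                             ∎
    where
    open ≡-Reasoning
    σᵏ0 = iter k (a0 ∷ [])

applyUpTo-cong-< : ∀ {A : Set} {f g : ℕ → A} n →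
  (∀ {j} → j < n → f j ≡ g j) → applyUpTo f n ≡ applyUpTo g n
applyUpTo-cong-< zero    f≡g = refl
applyUpTo-cong-< (suc n) f≡g = cong₂ _∷_ (f≡g z<s) (applyUpTo-cong-< n (f≡g ∘ s≤s))

applyUpTo-nth : ∀ {n} V → n ≤ length V → applyUpTo (λ j → nth j V) n ≡ take n V
applyUpTo-nth {zero}  V       _       = refl
applyUpTo-nth {suc n} (x ∷ V) (s≤s n≤V) = cong (x ∷_) (applyUpTo-nth V n≤V)

take-applyUpTo : ∀ {A : Set} (f : ℕ → A) {m n} →
  m ≤ n → take m (applyUpTo f n) ≡ applyUpTo f m
take-applyUpTo f z≤n       = refl
take-applyUpTo f (s≤s m≤n) = cong (f 0 ∷_) (take-applyUpTo (f ∘ suc) m≤n)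

drop-applyUpTo : ∀ {A : Set} (f : ℕ → A) i n →
  drop i (applyUpTo f (i + n)) ≡ applyUpTo (λ j → f (i + j)) n
drop-applyUpTo f zero    n = refl
drop-applyUpTo f (suc i) n = drop-applyUpTo (f ∘ suc) i n

𝐧-prefix : ∀ k → applyUpTo 𝐧 k ≡ take k (iter k (a0 ∷ []))
𝐧-prefix k = trans (applyUpTo-cong-< k (sym ∘ nth-σᵏ0))
                   (applyUpTo-nth (iter k (a0 ∷ [])) (k≤length-σᵏ0 k))

take-drop∈windows : ∀ {A : Set} n {i} (W : List A) →
  i < length W → take n (drop i W) ∈ windows n W
take-drop∈windows n {zero}  (x ∷ W) _         = here refl
take-drop∈windows n {suc i} (x ∷ W) (s≤s i<W) = there (take-drop∈windows n W i<W)

WindowsIn : ℕ → List (List Letter) → (ℕ → Letter) → Set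
WindowsIn n S f = ∀ i → applyUpTo (λ j → f (i + j)) n ∈ S

WindowsIn-shift : ∀ {n S} f i → WindowsIn n S f → WindowsIn n S (λ j → f (i + j))
WindowsIn-shift {n} {S} f i windows∈S k =
  subst (_∈ S) (applyUpTo-cong-< n (λ {j} _ → cong f (+-assoc i k j))) (windows∈S (i + k))

𝐧-windows : WindowsIn 5 S₅ 𝐧
𝐧-windows i = subst (_∈ S₅) (sym window≡)
  (All.lookup (windows-σᵏ0 (i + 5)) (take-drop∈windows 5 W i<W))
  where
  W = iter (i + 5) (a0 ∷ [])
  i<W : i < length W
  i<W = ≤-trans (m<m+n i z<s) (k≤length-σᵏ0 (i + 5))
  window≡ : applyUpTo (λ j → 𝐧 (i + j)) 5 ≡ take 5 (drop i W)
  window≡ = begin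
    applyUpTo (λ j → 𝐧 (i + j)) 5  ≡⟨ drop-applyUpTo 𝐧 i 5 ⟨
    drop i (applyUpTo 𝐧 (i + 5))   ≡⟨ cong (drop i) (𝐧-prefix (i + 5)) ⟩
    drop i (take (i + 5) W)        ≡⟨ take-drop 5 i W ⟨
    take 5 (drop i W)              ∎
    where open ≡-Reasoning

palindrome-inner : ∀ x m y → IsPalindrome (x ∷ m ∷ʳ y) → IsPalindrome m
palindrome-inner x m y pal =
  ∷ʳ-injectiveˡ (reverse m) m (∷-injectiveʳ (trans (sym reversed) pal))
  where
  reversed : reverse (x ∷ m ∷ʳ y) ≡ y ∷ reverse m ∷ʳ x
  reversed = trans (unfold-reverse x (m ∷ʳ y)) (cong (_∷ʳ x) (reverse-++ m (y ∷ [])))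

applyUpTo-inner-palindrome : ∀ (f : ℕ → Letter) n →
  IsPalindrome (applyUpTo f (2 + n)) → IsPalindrome (applyUpTo (f ∘ suc) n)
applyUpTo-inner-palindrome f n pal = palindrome-inner (f 0) _ (f (suc n))
  (subst (λ u → IsPalindrome (f 0 ∷ u)) (sym (applyUpTo-∷ʳ (f ∘ suc) n)) pal)

palindrome? : (w : List Letter) → Dec (IsPalindrome w)
palindrome? w = ≡-dec _≟_ (reverse w) w

palindromes : List (List Letter)
palindromes = (a0 ∷ []) ∷ (a1 ∷ []) ∷ (a2 ∷ []) ∷ (a0 ∷ a0 ∷ []) ∷ (a0 ∷ a1 ∷ a0 ∷ [])
            ∷ (a1 ∷ a0 ∷ a1 ∷ []) ∷ []

long∉palindromes : ∀ {a b c d : Letter} rest → a ∷ b ∷ c ∷ d ∷ rest ∉ palindromes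
long∉palindromes rest (there (there (there (there (there (there ()))))))

S₅-palindromic-prefixes : All (λ t → ∀ (ℓ : Fin 5) →
  IsPalindrome (take (suc (toℕ ℓ)) t) → take (suc (toℕ ℓ)) t ∈ palindromes) S₅
S₅-palindromic-prefixes = from-yes (all? (λ t → Fin.all? {n = 5} (λ ℓ →
  palindrome? (take (suc (toℕ ℓ)) t) →-dec (take (suc (toℕ ℓ)) t ∈? palindromes))) S₅)

short-palindrome∈ : ∀ f → WindowsIn 5 S₅ f → ∀ (ℓ : Fin 5) →
  IsPalindrome (applyUpTo f (suc (toℕ ℓ))) → applyUpTo f (suc (toℕ ℓ)) ∈ palindromes
short-palindrome∈ f windows∈S₅ ℓ pal = subst (_∈ palindromes) prefix≡
  (All.lookup S₅-palindromic-prefixes (windows∈S₅ 0) ℓ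
     (subst IsPalindrome (sym prefix≡) pal))
  where
  prefix≡ : take (suc (toℕ ℓ)) (applyUpTo f 5) ≡ applyUpTo f (suc (toℕ ℓ))
  prefix≡ = take-applyUpTo f (Fin.toℕ<n ℓ)

no-long-palindrome : ∀ f → WindowsIn 5 S₅ f → ∀ L → ¬ IsPalindrome (applyUpTo f (4 + L))
no-long-palindrome f windows∈S₅ 0 pal =
  long∉palindromes [] (short-palindrome∈ f windows∈S₅ (# 3) pal)
no-long-palindrome f windows∈S₅ 1 pal =
  long∉palindromes (_ ∷ []) (short-palindrome∈ f windows∈S₅ (# 4) pal)
no-long-palindrome f windows∈S₅ (suc (suc L)) pal =
  no-long-palindrome (f ∘ suc) (windows∈S₅ ∘ suc) L (applyUpTo-inner-palindrome f (4 + L) pal)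

palindrome∈ : ∀ f → WindowsIn 5 S₅ f →
  ∀ ℓ → IsPalindrome (applyUpTo f (suc ℓ)) → applyUpTo f (suc ℓ) ∈ palindromes
palindrome∈ f windows∈S₅ 0 = short-palindrome∈ f windows∈S₅ (# 0)
palindrome∈ f windows∈S₅ 1 = short-palindrome∈ f windows∈S₅ (# 1)
palindrome∈ f windows∈S₅ 2 = short-palindrome∈ f windows∈S₅ (# 2)
palindrome∈ f windows∈S₅ (suc (suc (suc L))) pal =
  ⊥-elim (no-long-palindrome f windows∈S₅ L pal)

palindromic-factor∈ : ∀ {w} → w ≢ [] → IsPalindrome w → IsFactor w → w ∈ palindromes
palindromic-factor∈ {[]}    w≢[] _   _            = ⊥-elim (w≢[] refl)
palindromic-factor∈ {x ∷ w} _    pal (i , factor) = subst (_∈ palindromes) factor≡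
  (palindrome∈ (λ j → 𝐧 (i + j)) (WindowsIn-shift 𝐧 i 𝐧-windows) (length w)
     (subst IsPalindrome (sym factor≡) pal))
  where
  factor≡ : applyUpTo (λ j → 𝐧 (i + j)) (suc (length w)) ≡ x ∷ w
  factor≡ = trans (sym (map-upTo _ (suc (length w)))) factor

Listed : List Letter → Set
Listed w = w ≡ a0 ∷ [] ⊎ w ≡ a1 ∷ [] ⊎ w ≡ a2 ∷ [] ⊎ w ≡ a0 ∷ a0 ∷ []
         ⊎ w ≡ a0 ∷ a1 ∷ a0 ∷ [] ⊎ w ≡ a1 ∷ a0 ∷ a1 ∷ []

∈palindromes⇒Listed : ∀ {w} → w ∈ palindromes → Listed w
∈palindromes⇒Listed (here e) = inj₁ e
∈palindromes⇒Listed (there (here e)) = inj₂ (inj₁ e)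
∈palindromes⇒Listed (there (there (here e))) = inj₂ (inj₂ (inj₁ e))
∈palindromes⇒Listed (there (there (there (here e)))) = inj₂ (inj₂ (inj₂ (inj₁ e)))
∈palindromes⇒Listed (there (there (there (there (here e))))) = inj₂ (inj₂ (inj₂ (inj₂ (inj₁ e))))
∈palindromes⇒Listed (there (there (there (there (there (here e)))))) =
  inj₂ (inj₂ (inj₂ (inj₂ (inj₂ e))))

Listed⇒palindromic-factor : ∀ {w} → Listed w → w ≢ [] × IsPalindrome w × IsFactor w
Listed⇒palindromic-factor (inj₁ refl)                             = (λ ()) , refl , 0 , refl
Listed⇒palindromic-factor (inj₂ (inj₁ refl))                      = (λ ()) , refl , 1 , refl
Listed⇒palindromic-factor (inj₂ (inj₂ (inj₁ refl)))               = (λ ()) , refl , 2 , refl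
Listed⇒palindromic-factor (inj₂ (inj₂ (inj₂ (inj₁ refl))))        = (λ ()) , refl , 3 , refl
Listed⇒palindromic-factor (inj₂ (inj₂ (inj₂ (inj₂ (inj₁ refl))))) = (λ ()) , refl , 4 , refl
Listed⇒palindromic-factor (inj₂ (inj₂ (inj₂ (inj₂ (inj₂ refl))))) = (λ ()) , refl , 5 , refl

proposition15 : (w : List Letter) →
    (w ≢ [] × IsPalindrome w × IsFactor w) ⇔
      (w ≡ a0 ∷ [] ⊎ w ≡ a1 ∷ [] ⊎ w ≡ a2 ∷ [] ⊎ w ≡ a0 ∷ a0 ∷ []
        ⊎ w ≡ a0 ∷ a1 ∷ a0 ∷ [] ⊎ w ≡ a1 ∷ a0 ∷ a1 ∷ [])
proposition15 w = mk⇔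
  (λ (w≢[] , pal , factor) → ∈palindromes⇒Listed (palindromic-factor∈ w≢[] pal factor))
  Listed⇒palindromic-factor
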